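{- Let $m$ be a positive integer with $\gcd(m,6)=1$. If the equation $8x^2+27y^2=8m$ has a solution $(x,y)\in\mathbb{Z}^2$ with $\gcd(x,y)=1$, then $m\equiv 1$ or $7\pmod{24}$. Moreover, if $(x_0,y_0)\in\mathbb{Z}^2$ is such a solution with $\gcd(x_0,y_0)=1$, then (a) if $m\equiv 1\pmod{24}$, then $\mathrm{val}_2(y_0)\geq 3$; (b) if $m\equiv 7\pmod{24}$, then $\mathrm{val}_2(y_0)=2$.
   Context: For a prime $\ell$ and a nonzero integer $n$, $\mathrm{val}_\ell(n)$ denotes the exponent of the highest power of $\ell$ dividing $n$ (with $\mathrm{val}_\ell(0)=+\infty$). -}

module Defs where

open import Data.Nat using (ℕ; _^_)
open import Data.Integer using (ℤ; +_)
open import Data.Integer.Divisibility using (_∣_)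
open import Data.Product using (_×_)
open import Relation.Nullary using (¬_)

-- val_ℓ(n) ≥ k  (with val_ℓ(0) = +∞), i.e. ℓ^k divides n
ValGE : ℕ → ℤ → ℕ → Set
ValGE ℓ n k = (+ (ℓ ^ k)) ∣ n

-- val_ℓ(n) = k  (false for n = 0, since val_ℓ(0) = +∞)
ValEq : ℕ → ℤ → ℕ → Set
ValEq ℓ n k = ValGE ℓ n k × ¬ ValGE ℓ n (Data.Nat.suc k)

-- Since 8 ∣ 27y² and 8 is coprime to 27, 8 ∣ y², which forces y = 4z; dividing the equation by 8
-- leaves x² + 54z² = m.  As m is prime to 6 so is x, whence x² ≡ 1 (mod 24), while 54z² is 0 or 6
-- (mod 24) according as z is even or odd.
module Submission where

open import Defs
open import Data.Product using (_×_; _,_; ∃; ∃₂; proj₁)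
open import Data.Sum as Sum using (_⊎_; inj₁; inj₂; [_,_]′)
open import Function using (id; _∘_; const)
open import Relation.Binary.PropositionalEquality
  using (_≡_; refl; sym; trans; cong; cong₂; subst; module ≡-Reasoning)
open import Relation.Nullary using (¬?; contradiction)

module _ where
  open import Data.Nat
  open import Data.Nat.Properties using (+-suc; *-cancelˡ-≡)
  open import Data.Nat.DivMod using (m%n<n; m*n%n≡0; [m+kn]%n≡m%n; %-distribˡ-+; %-distribˡ-*)
  open import Data.Nat.Divisibility
  open import Data.Nat.Coprimality using (Coprime; gcd≡1⇒coprime; coprime-divisor)
  open import Data.Nat.Primality using (Prime; prime[2]; euclidsLemma)
  open import Data.Nat.Tactic.RingSolver using (solve-∀)
  open import Data.Fin using (Fin; toℕ; fromℕ<)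
  open import Data.Fin.Properties using (all?; toℕ-fromℕ<)
  open import Relation.Nullary.Decidable using (toWitness; _→-dec_)

  even⊎odd : ∀ n → (∃ λ k → n ≡ 2 * k) ⊎ (∃ λ k → n ≡ 1 + 2 * k)
  even⊎odd zero = inj₁ (0 , refl)
  even⊎odd (suc n) with even⊎odd n
  ... | inj₁ (k , refl) = inj₂ (k , refl)
  ... | inj₂ (k , refl) = inj₁ (suc k , cong suc (sym (+-suc k (k + 0))))

  p∣n²⇒p∣n : ∀ {p} n → Prime p → p ∣ n * n → p ∣ n
  p∣n²⇒p∣n n pp p∣n² = [ id , id ]′ (euclidsLemma n n pp p∣n²)

  8∣n²⇒4∣n : ∀ n → 8 ∣ n * n → 4 ∣ n
  8∣n²⇒4∣n n 8∣n² with p∣n²⇒p∣n n prime[2] (∣-trans (divides 4 refl) 8∣n²)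
  ... | divides k refl = *-monoˡ-∣ 2 (p∣n²⇒p∣n k prime[2] 2∣k*k)
    where
    [2k]²≡4k² : ∀ k → (k * 2) * (k * 2) ≡ 4 * (k * k)
    [2k]²≡4k² = solve-∀
    2∣k*k : 2 ∣ k * k
    2∣k*k = *-cancelˡ-∣ 4 (subst (8 ∣_) ([2k]²≡4k² k) 8∣n²)

  8∤4 : 8 ∤ 4
  8∤4 (divides zero ())
  8∤4 (divides (suc _) ())

  2∤n⇒3∤n⇒n²%24≡1 : ∀ n → 2 ∤ n → 3 ∤ n → n * n % 24 ≡ 1
  2∤n⇒3∤n⇒n²%24≡1 n 2∤n 3∤n = begin
    n * n % 24  ≡⟨ %-distribˡ-* n n 24 ⟩
    r * r % 24  ≡⟨ residue-fact (2∤n ∘ ∣n∣m%n⇒∣m (divides 12 refl)) (3∤n ∘ ∣n∣m%n⇒∣m (divides 8 refl)) ⟩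
    1           ∎
    where
    open ≡-Reasoning
    r = n % 24
    P : ℕ → Set
    P r = 2 ∤ r → 3 ∤ r → r * r % 24 ≡ 1
    table : ∀ (i : Fin 24) → P (toℕ i)
    table = toWitness {a? = all? λ i → ¬? (2 ∣? toℕ i) →-dec ¬? (3 ∣? toℕ i) →-dec (toℕ i * toℕ i % 24 ≟ 1)} _
    residue-fact : P r
    residue-fact = subst P (toℕ-fromℕ< (m%n<n n 24)) (table (fromℕ< (m%n<n n 24)))

  d∣54⇒d∣x⇒d∣x²+54y² : ∀ {d} x y → d ∣ 54 → d ∣ x → d ∣ x * x + 54 * (y * y)
  d∣54⇒d∣x⇒d∣x²+54y² x y d∣54 d∣x = ∣m∣n⇒∣m+n (∣-trans d∣x (m∣m*n x)) (∣-trans d∣54 (m∣m*n (y * y)))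

  x²+54y²≡m⇒m%24 : ∀ x y m → x * x + 54 * (y * y) ≡ m → 2 ∤ m → 3 ∤ m →
    m % 24 ≡ (1 + 54 * (y * y) % 24) % 24
  x²+54y²≡m⇒m%24 x y m refl 2∤m 3∤m = begin
    (x * x + 54 * (y * y)) % 24            ≡⟨ %-distribˡ-+ (x * x) (54 * (y * y)) 24 ⟩
    (x * x % 24 + 54 * (y * y) % 24) % 24  ≡⟨ cong (λ r → (r + 54 * (y * y) % 24) % 24) x²%24≡1 ⟩
    (1 + 54 * (y * y) % 24) % 24           ∎
    where
    open ≡-Reasoning
    x²%24≡1 : x * x % 24 ≡ 1
    x²%24≡1 = 2∤n⇒3∤n⇒n²%24≡1 x (2∤m ∘ d∣54⇒d∣x⇒d∣x²+54y² x y (divides 27 refl))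
                                  (3∤m ∘ d∣54⇒d∣x⇒d∣x²+54y² x y (divides 18 refl))

  54*[2k]²%24≡0 : ∀ k → 54 * ((2 * k) * (2 * k)) % 24 ≡ 0
  54*[2k]²%24≡0 k = trans (cong (_% 24) (expand k)) (m*n%n≡0 (9 * (k * k)) 24)
    where
    expand : ∀ k → 54 * ((2 * k) * (2 * k)) ≡ 9 * (k * k) * 24
    expand = solve-∀

  54*[1+2k]²%24≡6 : ∀ k → 54 * ((1 + 2 * k) * (1 + 2 * k)) % 24 ≡ 6
  54*[1+2k]²%24≡6 k = trans (cong (_% 24) (expand k)) ([m+kn]%n≡m%n 6 (9 * (k * k) + 9 * k + 2) 24)
    where
    expand : ∀ k → 54 * ((1 + 2 * k) * (1 + 2 * k)) ≡ 6 + (9 * (k * k) + 9 * k + 2) * 24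
    expand = solve-∀

  8x²+27[4z]²≡8m⇒x²+54z²≡m : ∀ x z m → 8 * (x * x) + 27 * ((z * 4) * (z * 4)) ≡ 8 * m →
    x * x + 54 * (z * z) ≡ m
  8x²+27[4z]²≡8m⇒x²+54z²≡m x z m eq = *-cancelˡ-≡ _ _ 8 (trans (expand x z) eq)
    where
    expand : ∀ x z → 8 * (x * x + 54 * (z * z)) ≡ 8 * (x * x) + 27 * ((z * 4) * (z * 4))
    expand = solve-∀

  coprime-8-27 : Coprime 8 27
  coprime-8-27 = gcd≡1⇒coprime refl

  8x²+27y²≡8m⇒8∣y² : ∀ x y m → 8 * (x * x) + 27 * (y * y) ≡ 8 * m → 8 ∣ y * y
  8x²+27y²≡8m⇒8∣y² x y m eq =
    coprime-divisor coprime-8-27 (∣m+n∣m⇒∣n (subst (8 ∣_) (sym eq) (m∣m*n m)) (m∣m*n (x * x)))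

  Residue-Val₂ : ℕ → ℕ → Set
  Residue-Val₂ m y = (m % 24 ≡ 1 × 8 ∣ y) ⊎ (m % 24 ≡ 7 × 4 ∣ y × 8 ∤ y)

  8x²+27y²≡8m⇒Residue-Val₂ : ∀ x y m → 8 * (x * x) + 27 * (y * y) ≡ 8 * m → 2 ∤ m → 3 ∤ m →
    Residue-Val₂ m y
  8x²+27y²≡8m⇒Residue-Val₂ x y m eq 2∤m 3∤m = given-4∣y (8∣n²⇒4∣n y (8x²+27y²≡8m⇒8∣y² x y m eq))
    where
    given-4∣y : 4 ∣ y → Residue-Val₂ m y
    given-4∣y (divides z refl) = by-parity (even⊎odd z)
      where
      m%24 : m % 24 ≡ (1 + 54 * (z * z) % 24) % 24
      m%24 = x²+54y²≡m⇒m%24 x z m (8x²+27[4z]²≡8m⇒x²+54z²≡m x z m eq) 2∤m 3∤m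
      by-parity : (∃ λ k → z ≡ 2 * k) ⊎ (∃ λ k → z ≡ 1 + 2 * k) → Residue-Val₂ m (z * 4)
      by-parity (inj₁ (k , refl)) =
        inj₁ (trans m%24 (cong (λ r → (1 + r) % 24) (54*[2k]²%24≡0 k)) , divides k ([2k]*4≡k*8 k))
        where
        [2k]*4≡k*8 : ∀ k → (2 * k) * 4 ≡ k * 8
        [2k]*4≡k*8 = solve-∀
      by-parity (inj₂ (k , refl)) =
        inj₂ (trans m%24 (cong (λ r → (1 + r) % 24) (54*[1+2k]²%24≡6 k)) , divides z refl , 8∤y)
        where
        [1+2k]*4≡k*8+4 : ∀ k → (1 + 2 * k) * 4 ≡ k * 8 + 4
        [1+2k]*4≡k*8+4 = solve-∀
        8∤y : 8 ∤ (1 + 2 * k) * 4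
        8∤y 8∣y = 8∤4 (∣m+n∣m⇒∣n (subst (8 ∣_) ([1+2k]*4≡k*8+4 k) 8∣y) (n∣m*n k))

import Data.Nat as ℕ
open import Data.Nat using (ℕ; _%_) renaming (_>_ to _>ℕ_)
open import Data.Nat.GCD using (gcd)
open import Data.Nat.Divisibility using (_∣_; _∤_; divides)
open import Data.Nat.Coprimality using (Coprime; gcd≡1⇒coprime)
open import Data.Integer using (ℤ; +_; -[1+_]; _+_; _*_; ∣_∣)
open import Data.Integer.Properties using (+-injective; pos-+; pos-*)
open import Data.Integer.GCD renaming (gcd to gcdℤ)

x*x≡∣x∣*∣x∣ : ∀ x → x * x ≡ + (∣ x ∣ ℕ.* ∣ x ∣)
x*x≡∣x∣*∣x∣ (+ n) = sym (pos-* n n)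
x*x≡∣x∣*∣x∣ -[1+ n ] = refl

8x²+27y²≡8m⇒8∣x∣²+27∣y∣²≡8m : ∀ x y m → (+ 8) * (x * x) + (+ 27) * (y * y) ≡ (+ 8) * (+ m) →
  8 ℕ.* (∣ x ∣ ℕ.* ∣ x ∣) ℕ.+ 27 ℕ.* (∣ y ∣ ℕ.* ∣ y ∣) ≡ 8 ℕ.* m
8x²+27y²≡8m⇒8∣x∣²+27∣y∣²≡8m x y m eq = +-injective (begin
  + (8 ℕ.* a² ℕ.+ 27 ℕ.* b²)          ≡⟨ pos-+ (8 ℕ.* a²) (27 ℕ.* b²) ⟩
  + (8 ℕ.* a²) + + (27 ℕ.* b²)         ≡⟨ cong₂ _+_ (pos-* 8 a²) (pos-* 27 b²) ⟩
  (+ 8) * (+ a²) + (+ 27) * (+ b²)     ≡⟨ cong₂ (λ u v → (+ 8) * u + (+ 27) * v) (x*x≡∣x∣*∣x∣ x) (x*x≡∣x∣*∣x∣ y) ⟨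
  (+ 8) * (x * x) + (+ 27) * (y * y)   ≡⟨ eq ⟩
  (+ 8) * (+ m)                        ≡⟨ pos-* 8 m ⟨
  + (8 ℕ.* m)                          ∎)
  where
  open ≡-Reasoning
  a² = ∣ x ∣ ℕ.* ∣ x ∣
  b² = ∣ y ∣ ℕ.* ∣ y ∣

lemma2p4 : (m : ℕ) → m >ℕ 0 → gcd m 6 ≡ 1 →
    ((∃₂ λ (x y : ℤ) → ((+ 8) * (x * x) + (+ 27) * (y * y) ≡ (+ 8) * (+ m)) × (gcdℤ x y ≡ + 1)) →
      (m % 24 ≡ 1 ⊎ m % 24 ≡ 7))
    × ((x₀ y₀ : ℤ) → (+ 8) * (x₀ * x₀) + (+ 27) * (y₀ * y₀) ≡ (+ 8) * (+ m) → gcdℤ x₀ y₀ ≡ + 1 →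
      (m % 24 ≡ 1 → ValGE 2 y₀ 3) × (m % 24 ≡ 7 → ValEq 2 y₀ 2))
lemma2p4 m _ gcd[m,6]≡1 = residue , valuation
  where
  coprime-m-6 : Coprime m 6
  coprime-m-6 = gcd≡1⇒coprime gcd[m,6]≡1
  2∤m : 2 ∤ m
  2∤m 2∣m = contradiction (coprime-m-6 (2∣m , divides 3 refl)) λ ()
  3∤m : 3 ∤ m
  3∤m 3∣m = contradiction (coprime-m-6 (3∣m , divides 2 refl)) λ ()
  residue-val₂ : ∀ x y → (+ 8) * (x * x) + (+ 27) * (y * y) ≡ (+ 8) * (+ m) → Residue-Val₂ m ∣ y ∣
  residue-val₂ x y eq =
    8x²+27y²≡8m⇒Residue-Val₂ ∣ x ∣ ∣ y ∣ m (8x²+27y²≡8m⇒8∣x∣²+27∣y∣²≡8m x y m eq) 2∤m 3∤m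
  residue : (∃₂ λ x y → ((+ 8) * (x * x) + (+ 27) * (y * y) ≡ (+ 8) * (+ m)) × (gcdℤ x y ≡ + 1)) →
    m % 24 ≡ 1 ⊎ m % 24 ≡ 7
  residue (x , y , eq , _) = Sum.map proj₁ proj₁ (residue-val₂ x y eq)
  valuation : ∀ x y → (+ 8) * (x * x) + (+ 27) * (y * y) ≡ (+ 8) * (+ m) → gcdℤ x y ≡ + 1 →
    (m % 24 ≡ 1 → ValGE 2 y 3) × (m % 24 ≡ 7 → ValEq 2 y 2)
  valuation x y eq _ = to-valuations (residue-val₂ x y eq)
    where
    to-valuations : Residue-Val₂ m ∣ y ∣ → (m % 24 ≡ 1 → ValGE 2 y 3) × (m % 24 ≡ 7 → ValEq 2 y 2)
    to-valuations (inj₁ (≡1 , 8∣y))       = const 8∣y , λ ≡7 → contradiction (trans (sym ≡1) ≡7) λ ()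
    to-valuations (inj₂ (≡7 , 4∣y , 8∤y)) = (λ ≡1 → contradiction (trans (sym ≡1) ≡7) λ ()) , const (4∣y , 8∤y)
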